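{- Every $w\in W_e^+$ has a reduced expression of the form $w=v_1\cdot\pi\cdot v_2\cdot\pi\cdots v_d\cdot\pi\cdot v_{d+1}$ with $v_1,\dots,v_{d+1}\in W_f$, i.e. $w=v_1\pi v_2\pi\cdots v_d\pi v_{d+1}$ and $\ell(w)=\sum_{i=1}^{d+1}\ell(v_i)$.
   Context: Fix $n\ge2$. $W_e$: bijections $w:\mathbb Z\to\mathbb Z$ with $w(i+n)=w(i)+n$ (and $\sum_{i=1}^n(w(i)-i)\equiv0\bmod n$); $s_i$ swaps $i+kn,i+1+kn$; $\pi:k\mapsto k+1$; $W_a=\langle s_0,\dots,s_{n-1}\rangle$ is the Coxeter group of type $\tilde A_{n-1}$, $W_e=\langle\pi\rangle\ltimes W_a$, $\pi s_i\pi^{ -1}=s_{i+1}$, and $\ell(\pi^kv)=\ell(v)$ for $v\in W_a$. $W_f=\langle s_1,\dots,s_{n-1}\rangle$. The word of $w$ is $w_i=n+1-w^{ -1}(i)$; $W_e^+=\{w\in W_e:w_i>0\text{ for all }i\in[n]\}$. -}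

module Defs where

open import Data.Nat as ℕ using (ℕ; suc; NonZero)
open import Data.Integer using (ℤ; +_; _+_; _-_; _<_; _%ℕ_; 0ℤ; 1ℤ)
open import Data.Integer.Divisibility using (_∣_)
open import Data.Fin using (Fin; toℕ)
open import Data.List using (List; []; _∷_; length; map; foldr; upTo)
open import Data.List.Relation.Unary.All using (All)
open import Data.Product using (Σ; _×_; ∃-syntax)
open import Relation.Binary.PropositionalEquality using (_≡_)
open import Relation.Nullary.Decidable using (does)
open import Data.Bool using (if_then_else_)

-- Elements of the extended affine symmetric group W_e (for fixed n):
-- bijections w : ℤ → ℤ (given with their two-sided inverse)
-- with w(i+n) = w(i)+n and  Σ_{i=1}^n (w(i) - i) ≡ 0 mod n.
sumℤ : List ℤ → ℤ
sumℤ = foldr _+_ 0ℤ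

record AffPerm (n : ℕ) : Set where
  field
    fun     : ℤ → ℤ
    inv     : ℤ → ℤ
    fun∘inv : ∀ x → fun (inv x) ≡ x
    inv∘fun : ∀ x → inv (fun x) ≡ x
    period  : ∀ x → fun (x + + n) ≡ fun x + + n
    sumCond : (+ n) ∣ sumℤ (map (λ k → fun (+ suc k) - + suc k) (upTo n))
open AffPerm public

wordEntry : {n : ℕ} → AffPerm n → ℕ → ℤ
wordEntry {n} w i = + suc n - inv w (+ i)

IsPositive : {n : ℕ} → AffPerm n → Set
IsPositive {n} w = ∀ (i : ℕ) → 1 ℕ.≤ i → i ℕ.≤ n → + 0 < wordEntry w i

sGen : (n : ℕ) .{{_ : NonZero n}} → Fin n → ℤ → ℤ
sGen n i x =
  if does ((x %ℕ n) ℕ.≟ toℕ i) then x + 1ℤ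
  else if does ((x %ℕ n) ℕ.≟ (suc (toℕ i) ℕ.% n)) then x - 1ℤ
  else x

πmap : ℤ → ℤ
πmap x = x + 1ℤ

πpow : ℤ → ℤ → ℤ
πpow k x = x + k

evalS : (n : ℕ) .{{_ : NonZero n}} → List (Fin n) → ℤ → ℤ
evalS n []      x = x
evalS n (i ∷ u) x = sGen n i (evalS n u x)

-- Coxeter length on W_e: writing w = π^k v with v ∈ W_a = ⟨s_0,…,s_{n-1}⟩,
-- ℓ(w) = ℓ(v) = minimal length of a word in the s_i representing v.
-- "IsLength w m" says ℓ(w) = m.
IsLength : (n : ℕ) .{{_ : NonZero n}} → AffPerm n → ℕ → Set
IsLength n w m =
  (Σ ℤ λ k → Σ (List (Fin n)) λ u →
      (∀ x → fun w x ≡ πpow k (evalS n u x)) × length u ≡ m)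
  × (∀ (k : ℤ) (u : List (Fin n)) →
      (∀ x → fun w x ≡ πpow k (evalS n u x)) → m ℕ.≤ length u)

IsWfWord : {n : ℕ} → List (Fin n) → Set
IsWfWord = All (λ i → 1 ℕ.≤ toℕ i)

-- Expression v_1 π v_2 π ⋯ v_d π v_{d+1}, given as v_1 and the list [v_2,…,v_{d+1}].
evalExpr : (n : ℕ) .{{_ : NonZero n}} → List (Fin n) → List (List (Fin n)) → ℤ → ℤ
evalExpr n v []        x = evalS n v x
evalExpr n v (v′ ∷ vs) x = evalS n v (πmap (evalExpr n v′ vs x))

totalLength : {A : Set} → List A → List (List A) → ℕ
totalLength v vs = length v ℕ.+ foldr ℕ._+_ 0 (map length vs)

-- The length is handled through Shi's inversion formula
--   ℓ(w) = Σ_{1≤x<y≤n} |⌊(w(y) − w(x))/n⌋|.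
-- Composing with a simple reflection s_i changes exactly one term of this sum, by at most one,
-- and by exactly −1 when s_i is a left descent; since the formula vanishes on the identity and
-- ignores powers of π, it bounds the length of every word for w from below.
-- For the upper bound an expression is built greedily for w ∈ W_e^+: if 1 is not a window value,
-- split off π on the left; otherwise split off a left descent s_i with i ≠ 0. Both steps preserve
-- positivity of the window, and each lowers 2ℓ(w) + |w(1)|. When neither applies, the values
-- 1, 2, …, n sit at increasing window positions, so w is the identity. Finally s_i π = π s_{i−1}
-- moves all π's to the left, giving a word of the same total length.

module Submission where

open import Data.Empty using (⊥-elim)
open import Data.Fin using (Fin; toℕ; fromℕ<)
open import Data.Fin.Properties using (toℕ<n; toℕ-fromℕ<; any?)
open import Data.Integer as ℤ
  using (ℤ; +_; -[1+_]; +[1+_]; _+_; _-_; _*_; -_; ∣_∣; 0ℤ; 1ℤ; _%ℕ_; _/ℕ_; +<+; +≤+)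
open import Data.Integer.DivMod using (a≡a%ℕn+[a/ℕn]*n; n%ℕd<d)
import Data.Integer.Properties as ℤP
open import Data.Integer.Tactic.RingSolver using (solve-∀)
open import Data.List using (List; []; _∷_; length; map; _++_)
open import Data.List.Properties using (length-map; length-++)
import Data.List.Relation.Unary.All as All
open All using (All; []; _∷_)
open import Data.Nat as ℕ using (ℕ; zero; suc; NonZero; z≤n; s≤s)
open import Data.Nat.DivMod using (m<n⇒m%n≡m; n%n≡0; m%n<n)
import Data.Nat.Properties as ℕP
import Data.Nat.Tactic.RingSolver as ℕSolver
open import Data.Product using (Σ; _×_; _,_; proj₁; proj₂)
open import Data.Sum using (_⊎_; inj₁; inj₂)
open import Function using (_∘_)
open import Relation.Binary.Definitions using (tri<; tri≈; tri>)
open import Relation.Binary.PropositionalEquality hiding (J)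
open import Relation.Nullary using (¬_; yes; no)
open import Relation.Nullary.Decidable using (_×-dec_; dec-true; dec-false)

open import Algebra.Properties.AbelianGroup ℤP.+-0-abelianGroup using (∙-cancelʳ)
open import Algebra.Properties.CommutativeSemigroup ℕP.+-commutativeSemigroup using (xy∙z≈xz∙y; x∙yz≈xz∙y)

open import Defs

private
  x+1-1≡x : ∀ x → (x + 1ℤ) - 1ℤ ≡ x
  x+1-1≡x = solve-∀

  x-1+1≡x : ∀ x → (x - 1ℤ) + 1ℤ ≡ x
  x-1+1≡x = solve-∀

  a≡b+[a-b] : ∀ a b → a ≡ b + (a - b)
  a≡b+[a-b] = solve-∀

  a+tM-tM≡a : ∀ a t M → (a + t * M) + (- t) * M ≡ a
  a+tM-tM≡a = solve-∀

  r+qM+1≡[1+r]+qM : ∀ r q M → (r + q * M) + 1ℤ ≡ (1ℤ + r) + q * M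
  r+qM+1≡[1+r]+qM = solve-∀

  y+[1+k]≡[y+k]+1 : ∀ y k → y + (1ℤ + k) ≡ (y + k) + 1ℤ
  y+[1+k]≡[y+k]+1 = solve-∀

  +-right-comm : ∀ a b c → (a + b) + c ≡ (a + c) + b
  +-right-comm = solve-∀

  b-[a+1]≡b-a-1 : ∀ a b → b - (a + 1ℤ) ≡ (b - a) - 1ℤ
  b-[a+1]≡b-a-1 = solve-∀

  b-1-a≡b-a-1 : ∀ a b → (b - 1ℤ) - a ≡ (b - a) - 1ℤ
  b-1-a≡b-a-1 = solve-∀

  b+1-a-1≡b-a : ∀ a b → ((b + 1ℤ) - a) - 1ℤ ≡ b - a
  b+1-a-1≡b-a = solve-∀

  b-[a-1]-1≡b-a : ∀ a b → (b - (a - 1ℤ)) - 1ℤ ≡ b - a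
  b-[a-1]-1≡b-a = solve-∀

  b-1-[a+1]≡b-a-1-1 : ∀ a b → (b - 1ℤ) - (a + 1ℤ) ≡ ((b - a) - 1ℤ) - 1ℤ
  b-1-[a+1]≡b-a-1-1 = solve-∀

  a-b≡[a+1]-[b-1]-1-1 : ∀ a b → a - b ≡ ((a + 1ℤ) - (b - 1ℤ) - 1ℤ) - 1ℤ
  a-b≡[a+1]-[b-1]-1-1 = solve-∀

  a+1-a≡1 : ∀ a → (a + 1ℤ) - a ≡ 1ℤ
  a+1-a≡1 = solve-∀

  [a+1]-[b-1]≡1+a-b+1 : ∀ a b → (a + 1ℤ) - (b - 1ℤ) ≡ ((1ℤ + a) - b) + 1ℤ
  [a+1]-[b-1]≡1+a-b+1 = solve-∀

  b≡a+1+tM⇒b-a≡1+tM : ∀ a b t M → b ≡ (a + 1ℤ) + t * M → b - a ≡ 1ℤ + t * M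
  b≡a+1+tM⇒b-a≡1+tM a _ t M refl = identity a t M
    where
      identity : ∀ a t M → ((a + 1ℤ) + t * M) - a ≡ 1ℤ + t * M
      identity = solve-∀

  b≡a+1+tM⇒[a+1]-[b-1]≡1-tM : ∀ a b t M → b ≡ (a + 1ℤ) + t * M → (a + 1ℤ) - (b - 1ℤ) ≡ 1ℤ + (- t) * M
  b≡a+1+tM⇒[a+1]-[b-1]≡1-tM a _ t M refl = identity a t M
    where
      identity : ∀ a t M → (a + 1ℤ) - (((a + 1ℤ) + t * M) - 1ℤ) ≡ 1ℤ + (- t) * M
      identity = solve-∀

+-transfer : ∀ {a b c d x y} → a ℕ.+ c ≡ b ℕ.+ d → d ℕ.+ x ≡ c ℕ.+ y → a ℕ.+ x ≡ b ℕ.+ y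
+-transfer {a} {b} {c} {d} {x} {y} ac≡bd dx≡cy = ℕP.+-cancelʳ-≡ c _ _ (begin
  (a ℕ.+ x) ℕ.+ c   ≡⟨ xy∙z≈xz∙y a x c ⟩
  (a ℕ.+ c) ℕ.+ x   ≡⟨ cong (ℕ._+ x) ac≡bd ⟩
  (b ℕ.+ d) ℕ.+ x   ≡⟨ ℕP.+-assoc b d x ⟩
  b ℕ.+ (d ℕ.+ x)   ≡⟨ cong (b ℕ.+_) dx≡cy ⟩
  b ℕ.+ (c ℕ.+ y)   ≡⟨ x∙yz≈xz∙y b c y ⟩
  (b ℕ.+ y) ℕ.+ c   ∎)
  where open ≡-Reasoning

+-transfer-≤ : ∀ {a b c d} → a ℕ.+ b ≡ c ℕ.+ d → d ℕ.≤ b ℕ.+ 1 → a ℕ.≤ c ℕ.+ 1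
+-transfer-≤ {a} {b} {c} {d} ab≡cd d≤b+1 = ℕP.+-cancelʳ-≤ b a (c ℕ.+ 1) (begin
  a ℕ.+ b          ≡⟨ ab≡cd ⟩
  c ℕ.+ d          ≤⟨ ℕP.+-monoʳ-≤ c d≤b+1 ⟩
  c ℕ.+ (b ℕ.+ 1)  ≡⟨ x∙yz≈xz∙y c b 1 ⟩
  (c ℕ.+ 1) ℕ.+ b  ∎)
  where open ℕP.≤-Reasoning

+-transfer-≡ : ∀ {a b c d} → a ℕ.+ b ≡ c ℕ.+ d → d ℕ.+ 1 ≡ b → a ℕ.+ 1 ≡ c
+-transfer-≡ {a} {b} {c} {d} ab≡cd d+1≡b =
  trans (+-transfer {a} {c} {b} {d} {1} {0} ab≡cd (trans d+1≡b (sym (ℕP.+-identityʳ b)))) (ℕP.+-identityʳ c)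

measure-shift : ∀ {A B X′ X} → A ≡ B → X′ ℕ.+ 1 ≡ X → (A ℕ.+ A) ℕ.+ X′ ℕ.< (B ℕ.+ B) ℕ.+ X
measure-shift {A} {X′ = X′} refl refl = ℕP.+-monoʳ-< (A ℕ.+ A) (ℕP.m<m+n X′ (s≤s z≤n))

measure-reflection : ∀ {A B X′ X} → A ℕ.+ 1 ≡ B → X′ ℕ.≤ X ℕ.+ 1 → (A ℕ.+ A) ℕ.+ X′ ℕ.< (B ℕ.+ B) ℕ.+ X
measure-reflection {A} {X = X} refl X′≤X+1 =
  ℕP.≤-trans (s≤s (ℕP.+-monoʳ-≤ (A ℕ.+ A) X′≤X+1)) (ℕP.≤-reflexive (regroup A X))
  where
    regroup : ∀ A X → suc ((A ℕ.+ A) ℕ.+ (X ℕ.+ 1)) ≡ ((A ℕ.+ 1) ℕ.+ (A ℕ.+ 1)) ℕ.+ X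
    regroup = ℕSolver.solve-∀

∣i-1∣≤∣i∣+1 : ∀ i → ∣ i - 1ℤ ∣ ℕ.≤ ∣ i ∣ ℕ.+ 1
∣i-1∣≤∣i∣+1 i = ℤP.∣i+j∣≤∣i∣+∣j∣ i (- 1ℤ)

∣i∣≤∣i-1∣+1 : ∀ i → ∣ i ∣ ℕ.≤ ∣ i - 1ℤ ∣ ℕ.+ 1
∣i∣≤∣i-1∣+1 i = subst (λ j → ∣ j ∣ ℕ.≤ ∣ i - 1ℤ ∣ ℕ.+ 1) (x-1+1≡x i) (ℤP.∣i+j∣≤∣i∣+∣j∣ (i - 1ℤ) 1ℤ)

0<i⇒∣i-1∣+1≡∣i∣ : ∀ {i} → 0ℤ ℤ.< i → ∣ i - 1ℤ ∣ ℕ.+ 1 ≡ ∣ i ∣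
0<i⇒∣i-1∣+1≡∣i∣ {+[1+ m ]} _        = ℕP.+-comm m 1
0<i⇒∣i-1∣+1≡∣i∣ {+ zero}   (+<+ ())

i≤0⇒∣i∣+1≡∣i-1∣ : ∀ {i} → i ℤ.≤ 0ℤ → ∣ i ∣ ℕ.+ 1 ≡ ∣ i - 1ℤ ∣
i≤0⇒∣i∣+1≡∣i-1∣ {+ zero}    _        = refl
i≤0⇒∣i∣+1≡∣i-1∣ {+[1+ m ]}  (+≤+ ())
i≤0⇒∣i∣+1≡∣i-1∣ { -[1+ m ]} _        = cong suc (trans (ℕP.+-comm m 1) (cong suc (sym (ℕP.+-identityʳ m))))

0<i⇒0<i+1 : ∀ {i} → 0ℤ ℤ.< i → 0ℤ ℤ.< i + 1ℤ
0<i⇒0<i+1 {+[1+ m ]} _        = +<+ (s≤s z≤n)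
0<i⇒0<i+1 {+ zero}   (+<+ ())

0<i⇒i≢1⇒0<i-1 : ∀ {i} → 0ℤ ℤ.< i → i ≢ 1ℤ → 0ℤ ℤ.< i - 1ℤ
0<i⇒i≢1⇒0<i-1 {+[1+ zero ]}  _        i≢1 = ⊥-elim (i≢1 refl)
0<i⇒i≢1⇒0<i-1 {+[1+ suc m ]} _        _   = +<+ (s≤s z≤n)
0<i⇒i≢1⇒0<i-1 {+ zero}       (+<+ ()) _

Σ< : (ℕ → ℕ) → ℕ → ℕ
Σ< f zero    = 0
Σ< f (suc b) = Σ< f b ℕ.+ f b

Σ<-cong : ∀ {f g} b → (∀ {x} → x ℕ.< b → f x ≡ g x) → Σ< f b ≡ Σ< g b
Σ<-cong zero    f≗g = refl
Σ<-cong (suc b) f≗g = cong₂ ℕ._+_ (Σ<-cong b (f≗g ∘ ℕP.m<n⇒m<1+n)) (f≗g (ℕP.n<1+n b))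

Σ<-zero : ∀ b → Σ< (λ _ → 0) b ≡ 0
Σ<-zero zero    = refl
Σ<-zero (suc b) = trans (ℕP.+-identityʳ _) (Σ<-zero b)

Σ<-update : ∀ {f g} b {x₀} → x₀ ℕ.< b → (∀ {x} → x ℕ.< b → x ≢ x₀ → f x ≡ g x) →
            Σ< f b ℕ.+ g x₀ ≡ Σ< g b ℕ.+ f x₀
Σ<-update {f} {g} (suc b) {x₀} x₀<1+b agree with ℕP.m≤n⇒m<n∨m≡n (ℕP.≤-pred x₀<1+b)
... | inj₂ refl = begin
  (Σ< f b ℕ.+ f b) ℕ.+ g b  ≡⟨ cong (λ t → (t ℕ.+ f b) ℕ.+ g b) (Σ<-cong b λ x<b → agree (ℕP.m<n⇒m<1+n x<b) (ℕP.<⇒≢ x<b)) ⟩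
  (Σ< g b ℕ.+ f b) ℕ.+ g b  ≡⟨ xy∙z≈xz∙y (Σ< g b) (f b) (g b) ⟩
  (Σ< g b ℕ.+ g b) ℕ.+ f b  ∎
  where open ≡-Reasoning
... | inj₁ x₀<b = begin
  (Σ< f b ℕ.+ f b) ℕ.+ g x₀  ≡⟨ xy∙z≈xz∙y (Σ< f b) (f b) (g x₀) ⟩
  (Σ< f b ℕ.+ g x₀) ℕ.+ f b  ≡⟨ cong₂ ℕ._+_ (Σ<-update b x₀<b (agree ∘ ℕP.m<n⇒m<1+n)) (agree (ℕP.n<1+n b) b≢x₀) ⟩
  (Σ< g b ℕ.+ f x₀) ℕ.+ g b  ≡⟨ xy∙z≈xz∙y (Σ< g b) (f x₀) (g b) ⟩
  (Σ< g b ℕ.+ g b) ℕ.+ f x₀  ∎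
  where
    open ≡-Reasoning
    b≢x₀ : b ≢ x₀
    b≢x₀ b≡x₀ = ℕP.<⇒≢ x₀<b (sym b≡x₀)

ΣΣ< : (ℕ → ℕ → ℕ) → ℕ → ℕ
ΣΣ< F m = Σ< (λ y → Σ< (λ x → F x y) y) m

ΣΣ<-cong : ∀ {F G} m → (∀ {x y} → x ℕ.< y → y ℕ.< m → F x y ≡ G x y) → ΣΣ< F m ≡ ΣΣ< G m
ΣΣ<-cong m F≗G = Σ<-cong m λ y<m → Σ<-cong _ λ x<y → F≗G x<y y<m

ΣΣ<-update : ∀ {F G} m {p q} → p ℕ.< q → q ℕ.< m →
             (∀ {x y} → x ℕ.< y → y ℕ.< m → ¬ (x ≡ p × y ≡ q) → F x y ≡ G x y) →
             ΣΣ< F m ℕ.+ G p q ≡ ΣΣ< G m ℕ.+ F p q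
ΣΣ<-update {F} {G} m {p} {q} p<q q<m agree = +-transfer {c = Σ< (λ x → G x q) q} {d = Σ< (λ x → F x q) q} outer inner
  where
    outer : ΣΣ< F m ℕ.+ Σ< (λ x → G x q) q ≡ ΣΣ< G m ℕ.+ Σ< (λ x → F x q) q
    outer = Σ<-update m q<m λ y<m y≢q → Σ<-cong _ λ x<y → agree x<y y<m (y≢q ∘ proj₂)
    inner : Σ< (λ x → F x q) q ℕ.+ G p q ≡ Σ< (λ x → G x q) q ℕ.+ F p q
    inner = Σ<-update q p<q λ x<q x≢p → agree x<q q<m (x≢p ∘ proj₁)

module AffinePermutations (n : ℕ) .{{_ : NonZero n}} where

  -- Division by n

  N : ℤ
  N = + n

  rem : ℤ → ℕ
  rem x = x %ℕ n

  quo : ℤ → ℤ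
  quo x = x /ℕ n

  0<n : 0 ℕ.< n
  0<n = ℕ.>-nonZero⁻¹ n

  n≡1+[n∸1] : n ≡ suc (n ℕ.∸ 1)
  n≡1+[n∸1] = sym (ℕP.m+[n∸m]≡n 0<n)

  n∸1<n : n ℕ.∸ 1 ℕ.< n
  n∸1<n = subst (n ℕ.∸ 1 ℕ.<_) (sym n≡1+[n∸1]) (ℕP.n<1+n _)

  rem<n : ∀ x → rem x ℕ.< n
  rem<n x = n%ℕd<d x n

  rem+quo*N : ∀ x → x ≡ + rem x + quo x * N
  rem+quo*N x = a≡a%ℕn+[a/ℕn]*n x n

  private
    a-b≡c⇒a≡b+c : ∀ {a b c} → a - b ≡ c → a ≡ b + c
    a-b≡c⇒a≡b+c {a} {b} refl = a≡b+[a-b] a b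

    positive-multiple-large : ∀ {r₁ r₂} m → + r₁ - + r₂ ≡ +[1+ m ] * N → n ℕ.≤ r₁
    positive-multiple-large {r₁} {r₂} m eq = subst (n ℕ.≤_) (sym r₁≡) n≤r₂+[1+m]n
      where
        r₁≡ : r₁ ≡ r₂ ℕ.+ suc m ℕ.* n
        r₁≡ = ℤP.+-injective (trans (a-b≡c⇒a≡b+c {b = + r₂} eq) (cong (λ z → + r₂ + z) (sym (ℤP.pos-* (suc m) n))))
        n≤r₂+[1+m]n : n ℕ.≤ r₂ ℕ.+ suc m ℕ.* n
        n≤r₂+[1+m]n = ℕP.≤-trans (ℕP.m≤m+n n (m ℕ.* n)) (ℕP.m≤n+m _ r₂)

  small-difference-multiple⇒0 : ∀ {r₁ r₂} d → r₁ ℕ.< n → r₂ ℕ.< n → + r₁ - + r₂ ≡ d * N → d ≡ 0ℤ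
  small-difference-multiple⇒0 (+ zero) _    _    _  = refl
  small-difference-multiple⇒0 {r₂ = r₂} +[1+ m ] r₁<n _    eq = ⊥-elim (ℕP.<⇒≱ r₁<n (positive-multiple-large {r₂ = r₂} m eq))
  small-difference-multiple⇒0 {r₁} {r₂} -[1+ m ] _ r₂<n eq =
    ⊥-elim (ℕP.<⇒≱ r₂<n (positive-multiple-large {r₂ = r₁} m (begin
      + r₂ - + r₁         ≡⟨ b-a≡-[a-b] (+ r₁) (+ r₂) ⟩
      - (+ r₁ - + r₂)     ≡⟨ cong -_ eq ⟩
      - (-[1+ m ] * N)    ≡⟨ ℤP.neg-distribˡ-* -[1+ m ] N ⟩
      +[1+ m ] * N        ∎)))
    where
      open ≡-Reasoning
      b-a≡-[a-b] : ∀ a b → b - a ≡ - (a - b)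
      b-a≡-[a-b] = solve-∀

  divMod-unique : ∀ {r₁ r₂} q₁ q₂ → r₁ ℕ.< n → r₂ ℕ.< n →
                  + r₁ + q₁ * N ≡ + r₂ + q₂ * N → r₁ ≡ r₂ × q₁ ≡ q₂
  divMod-unique {r₁} {r₂} q₁ q₂ r₁<n r₂<n eq = ℤP.+-injective r₁≡r₂ , q₁≡q₂
    where
      open ≡-Reasoning
      shift-sub : ∀ a b c → a - b ≡ (a + c) - (b + c)
      shift-sub = solve-∀
      difference : ∀ r q₁ q₂ M → (r + q₂ * M) - (r + q₁ * M) ≡ (q₂ - q₁) * M
      difference = solve-∀
      q₁≡q₂ : q₁ ≡ q₂
      q₁≡q₂ = sym (ℤP.i-j≡0⇒i≡j q₂ q₁ (small-difference-multiple⇒0 (q₂ - q₁) r₁<n r₂<n (begin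
        + r₁ - + r₂                          ≡⟨ shift-sub (+ r₁) (+ r₂) (q₁ * N) ⟩
        (+ r₁ + q₁ * N) - (+ r₂ + q₁ * N)    ≡⟨ cong (_- (+ r₂ + q₁ * N)) eq ⟩
        (+ r₂ + q₂ * N) - (+ r₂ + q₁ * N)    ≡⟨ difference (+ r₂) q₁ q₂ N ⟩
        (q₂ - q₁) * N                        ∎)))
      r₁≡r₂ : + r₁ ≡ + r₂
      r₁≡r₂ = ∙-cancelʳ (q₁ * N) (+ r₁) (+ r₂) (trans eq (cong (λ q → + r₂ + q * N) (sym q₁≡q₂)))

  rem-quo-unique : ∀ x {r} q → r ℕ.< n → x ≡ + r + q * N → rem x ≡ r × quo x ≡ q
  rem-quo-unique x q r<n eq = divMod-unique (quo x) q (rem<n x) r<n (trans (sym (rem+quo*N x)) eq)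

  rem-quo-+* : ∀ x t → rem (x + t * N) ≡ rem x × quo (x + t * N) ≡ quo x + t
  rem-quo-+* x t = rem-quo-unique (x + t * N) (quo x + t) (rem<n x) (begin
    x + t * N                    ≡⟨ cong (_+ t * N) (rem+quo*N x) ⟩
    (+ rem x + quo x * N) + t * N ≡⟨ regroup (+ rem x) (quo x) t N ⟩
    + rem x + (quo x + t) * N     ∎)
    where
      open ≡-Reasoning
      regroup : ∀ a q t M → (a + q * M) + t * M ≡ a + (q + t) * M
      regroup = solve-∀

  rem-+* : ∀ x t → rem (x + t * N) ≡ rem x
  rem-+* x t = proj₁ (rem-quo-+* x t)

  rem-+N : ∀ x → rem (x + N) ≡ rem x
  rem-+N x = trans (cong (λ m → rem (x + m)) (sym (ℤP.*-identityˡ N))) (rem-+* x 1ℤ)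

  same-rem⇒differ-by-multiple : ∀ a b → rem a ≡ rem b → a ≡ b + (quo a - quo b) * N
  same-rem⇒differ-by-multiple a b eq = begin
    a                              ≡⟨ rem+quo*N a ⟩
    + rem a + quo a * N            ≡⟨ cong (λ r → + r + quo a * N) eq ⟩
    + rem b + quo a * N            ≡⟨ regroup (+ rem b) (quo a) (quo b) N ⟩
    (+ rem b + quo b * N) + (quo a - quo b) * N ≡⟨ cong (_+ (quo a - quo b) * N) (sym (rem+quo*N b)) ⟩
    b + (quo a - quo b) * N        ∎
    where
      open ≡-Reasoning
      regroup : ∀ r qa qb M → r + qa * M ≡ (r + qb * M) + (qa - qb) * M
      regroup = solve-∀

  rem-+1 : ∀ a → rem (a + 1ℤ) ≡ suc (rem a) ℕ.% n
  rem-+1 a = trans (cong rem (trans (cong (_+ 1ℤ) (rem+quo*N a)) (r+qM+1≡[1+r]+qM (+ rem a) (quo a) N)))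
                   (rem-+* (+ suc (rem a)) (quo a))

  suc-%-cases : ∀ {x} → x ℕ.< n → (suc x ℕ.% n ≡ suc x) ⊎ (suc x ℕ.% n ≡ 0 × suc x ≡ n)
  suc-%-cases x<n with ℕP.m≤n⇒m<n∨m≡n x<n
  ... | inj₁ 1+x<n = inj₁ (m<n⇒m%n≡m 1+x<n)
  ... | inj₂ 1+x≡n = inj₂ (trans (cong (ℕ._% n) 1+x≡n) (n%n≡0 n) , 1+x≡n)

  suc-%-injective : ∀ {x y} → x ℕ.< n → y ℕ.< n → suc x ℕ.% n ≡ suc y ℕ.% n → x ≡ y
  suc-%-injective x<n y<n eq with suc-%-cases x<n | suc-%-cases y<n
  ... | inj₁ ex       | inj₁ ey       = ℕP.suc-injective (trans (sym ex) (trans eq ey))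
  ... | inj₁ ex       | inj₂ (ey , _) with () ← trans (sym ex) (trans eq ey)
  ... | inj₂ (ex , _) | inj₁ ey       with () ← trans (sym ey) (trans (sym eq) ex)
  ... | inj₂ (_ , ex) | inj₂ (_ , ey) = ℕP.suc-injective (trans ex (sym ey))

  rem-pred : ∀ a {i} → i ℕ.< n → rem a ≡ suc i ℕ.% n → rem (a - 1ℤ) ≡ i
  rem-pred a i<n eq = suc-%-injective (rem<n (a - 1ℤ)) i<n
    (trans (sym (rem-+1 (a - 1ℤ))) (trans (cong rem (x-1+1≡x a)) eq))

  quo-pred : ∀ D → rem D ≢ 0 → quo (D - 1ℤ) ≡ quo D
  quo-pred D rem≢0 with rem D in eq
  ... | zero  = ⊥-elim (rem≢0 refl)
  ... | suc k = proj₂ (rem-quo-unique (D - 1ℤ) (quo D) k<n (begin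
    D - 1ℤ                    ≡⟨ cong (_- 1ℤ) (rem+quo*N D) ⟩
    (+ rem D + quo D * N) - 1ℤ ≡⟨ cong (λ r → (+ r + quo D * N) - 1ℤ) eq ⟩
    (1ℤ + + k + quo D * N) - 1ℤ ≡⟨ cancel-1 (+ k) (quo D) N ⟩
    + k + quo D * N           ∎))
    where
      open ≡-Reasoning
      k<n : k ℕ.< n
      k<n = ℕP.<-trans (ℕP.n<1+n k) (subst (ℕ._< n) eq (rem<n D))
      cancel-1 : ∀ k q M → (1ℤ + k + q * M) - 1ℤ ≡ k + q * M
      cancel-1 = solve-∀

  quo-pred² : ∀ D → rem D ≡ 1 → quo ((D - 1ℤ) - 1ℤ) ≡ quo D - 1ℤ
  quo-pred² D eq = proj₂ (rem-quo-unique ((D - 1ℤ) - 1ℤ) (quo D - 1ℤ) n∸1<n (begin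
    (D - 1ℤ) - 1ℤ                                   ≡⟨ cong (λ x → (x - 1ℤ) - 1ℤ) (rem+quo*N D) ⟩
    ((+ rem D + quo D * N) - 1ℤ) - 1ℤ               ≡⟨ cong (λ r → ((+ r + quo D * N) - 1ℤ) - 1ℤ) eq ⟩
    ((1ℤ + quo D * N) - 1ℤ) - 1ℤ                    ≡⟨ cong (λ m → ((1ℤ + quo D * m) - 1ℤ) - 1ℤ) N≡1+[n-1] ⟩
    ((1ℤ + quo D * (1ℤ + K)) - 1ℤ) - 1ℤ             ≡⟨ borrow K (quo D) ⟩
    K + (quo D - 1ℤ) * (1ℤ + K)                     ≡⟨ cong (λ m → K + (quo D - 1ℤ) * m) (sym N≡1+[n-1]) ⟩
    K + (quo D - 1ℤ) * N                            ∎))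
    where
      open ≡-Reasoning
      K : ℤ
      K = + (n ℕ.∸ 1)
      N≡1+[n-1] : N ≡ 1ℤ + K
      N≡1+[n-1] = cong +_ n≡1+[n∸1]
      borrow : ∀ k q → ((1ℤ + q * (1ℤ + k)) - 1ℤ) - 1ℤ ≡ k + (q - 1ℤ) * (1ℤ + k)
      borrow = solve-∀

  distinct-rem⇒difference-rem≢0 : ∀ a b → rem a ≢ rem b → rem (b - a) ≢ 0
  distinct-rem⇒difference-rem≢0 a b ne rem≡0 = ne (sym (trans (cong rem b≡) (rem-+* a (quo (b - a)))))
    where
      regroup : ∀ a b q → b - a ≡ + 0 + q * N → b ≡ a + q * N
      regroup a b q eq = trans (a≡b+[a-b] b a) (trans (cong (λ z → a + z) eq) (drop-zero a q N))
        where
          drop-zero : ∀ a q M → a + (0ℤ + q * M) ≡ a + q * M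
          drop-zero = solve-∀
      b≡ : b ≡ a + quo (b - a) * N
      b≡ = regroup a b (quo (b - a)) (trans (rem+quo*N (b - a)) (cong (λ r → + r + quo (b - a) * N) rem≡0))

  window-representative : ∀ x → Σ ℕ λ p → p ℕ.< n × Σ ℤ λ t → x ≡ + suc p + t * N
  window-representative x = rem (x - 1ℤ) , rem<n (x - 1ℤ) , quo (x - 1ℤ) , (begin
    x                                        ≡⟨ x-1+1≡x x ⟨
    (x - 1ℤ) + 1ℤ                            ≡⟨ cong (_+ 1ℤ) (rem+quo*N (x - 1ℤ)) ⟩
    (+ rem (x - 1ℤ) + quo (x - 1ℤ) * N) + 1ℤ ≡⟨ r+qM+1≡[1+r]+qM (+ rem (x - 1ℤ)) (quo (x - 1ℤ)) N ⟩
    (1ℤ + + rem (x - 1ℤ)) + quo (x - 1ℤ) * N ∎)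
    where open ≡-Reasoning

  private
    -[1+m]*N≤0 : ∀ m → -[1+ m ] * N ℤ.≤ 0ℤ
    -[1+m]*N≤0 m = subst (ℤ._≤ 0ℤ) (trans (cong -_ (ℤP.pos-* (suc m) n)) (ℤP.neg-distribˡ-* +[1+ m ] N)) ℤP.neg-≤-pos

    1+uN>1⇒u>0 : ∀ u → 1ℤ ℤ.< 1ℤ + u * N → 0ℤ ℤ.< u
    1+uN>1⇒u>0 (+ zero)  1<1 = ⊥-elim (ℤP.<-irrefl refl 1<1)
    1+uN>1⇒u>0 +[1+ m ] _   = +<+ (s≤s z≤n)
    1+uN>1⇒u>0 -[1+ m ] 1<D =
      ⊥-elim (ℤP.<⇒≱ 1<D (ℤP.≤-trans (ℤP.+-monoʳ-≤ 1ℤ (-[1+m]*N≤0 m)) (ℤP.≤-reflexive (ℤP.+-identityʳ 1ℤ))))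

    1+uN≤1⇒u≤0 : ∀ u → 1ℤ + u * N ℤ.≤ 1ℤ → u ℤ.≤ 0ℤ
    1+uN≤1⇒u≤0 (+ zero)  _   = +≤+ z≤n
    1+uN≤1⇒u≤0 -[1+ m ] _   = ℤ.-≤+
    1+uN≤1⇒u≤0 +[1+ m ] D≤1 =
      ⊥-elim (ℕP.<⇒≱ 1<D (ℤP.drop‿+≤+ (subst (ℤ._≤ 1ℤ) (cong (λ z → 1ℤ + z) (sym (ℤP.pos-* (suc m) n))) D≤1)))
      where
        1<D : 1 ℕ.< 1 ℕ.+ suc m ℕ.* n
        1<D = s≤s (ℕP.≤-trans 0<n (ℕP.m≤m+n n (m ℕ.* n)))

  rem≡1⇒≡1+quo*N : ∀ D → rem D ≡ 1 → D ≡ 1ℤ + quo D * N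
  rem≡1⇒≡1+quo*N D rem≡1 = trans (rem+quo*N D) (cong (λ r → + r + quo D * N) rem≡1)

  rem≡1⇒quo>0 : ∀ D → rem D ≡ 1 → 1ℤ ℤ.< D → 0ℤ ℤ.< quo D
  rem≡1⇒quo>0 D rem≡1 1<D = 1+uN>1⇒u>0 (quo D) (subst (1ℤ ℤ.<_) (rem≡1⇒≡1+quo*N D rem≡1) 1<D)

  rem≡1⇒quo≤0 : ∀ D → rem D ≡ 1 → D ℤ.≤ 1ℤ → quo D ℤ.≤ 0ℤ
  rem≡1⇒quo≤0 D rem≡1 D≤1 = 1+uN≤1⇒u≤0 (quo D) (subst (ℤ._≤ 1ℤ) (rem≡1⇒≡1+quo*N D rem≡1) D≤1)

  -- Periodic bijections and the inversion count

  entry : (ℤ → ℤ) → ℕ → ℤ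
  entry g p = g (+ suc p)

  -- AffPerm without the sum condition, which the length argument never uses.
  record IsPeriodicBijection (g : ℤ → ℤ) : Set where
    field
      periodic  : ∀ x → g (x + N) ≡ g x + N
      preimage  : ℤ → ℤ
      section   : ∀ y → g (preimage y) ≡ y
      injective : ∀ {x y} → g x ≡ g y → x ≡ y

  open IsPeriodicBijection

  module _ {g : ℤ → ℤ} (g-bij : IsPeriodicBijection g) where

    periodic-ℕ : ∀ m x → g (x + + m * N) ≡ g x + + m * N
    periodic-ℕ zero    x = trans (cong g (ℤP.+-identityʳ x)) (sym (ℤP.+-identityʳ (g x)))
    periodic-ℕ (suc m) x = begin
      g (x + + suc m * N)       ≡⟨ cong g (peel x (+ m) N) ⟩
      g ((x + + m * N) + N)     ≡⟨ periodic g-bij _ ⟩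
      g (x + + m * N) + N       ≡⟨ cong (_+ N) (periodic-ℕ m x) ⟩
      (g x + + m * N) + N       ≡⟨ sym (peel (g x) (+ m) N) ⟩
      g x + + suc m * N         ∎
      where
        open ≡-Reasoning
        peel : ∀ x k M → x + (1ℤ + k) * M ≡ (x + k * M) + M
        peel = solve-∀

    periodic-* : ∀ t x → g (x + t * N) ≡ g x + t * N
    periodic-* (+ m)    x = periodic-ℕ m x
    periodic-* -[1+ m ] x = begin
      g y                                 ≡⟨ a+tM-tM≡a (g y) +[1+ m ] N ⟨
      (g y + +[1+ m ] * N) + -[1+ m ] * N ≡⟨ cong (_+ -[1+ m ] * N) (periodic-ℕ (suc m) y) ⟨
      g (y + +[1+ m ] * N) + -[1+ m ] * N ≡⟨ cong (λ z → g z + -[1+ m ] * N) (a+tM-tM≡a x -[1+ m ] N) ⟩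
      g x + -[1+ m ] * N                  ∎
      where
        open ≡-Reasoning
        y = x + -[1+ m ] * N

    rem-entry-injective : ∀ {p p′} → p ℕ.< n → p′ ℕ.< n → rem (entry g p) ≡ rem (entry g p′) → p ≡ p′
    rem-entry-injective {p} {p′} p<n p′<n eq =
      trans (sym (m<n⇒m%n≡m p<n)) (proj₁ (rem-quo-unique (+ p) t p′<n (drop-suc (+ p) (+ p′) (t * N) same-argument)))
      where
        t = quo (entry g p) - quo (entry g p′)
        same-argument : + suc p ≡ + suc p′ + t * N
        same-argument = injective g-bij
          (trans (same-rem⇒differ-by-multiple (entry g p) (entry g p′) eq) (sym (periodic-* t (+ suc p′))))
        drop-suc : ∀ a b c → 1ℤ + a ≡ (1ℤ + b) + c → a ≡ b + c
        drop-suc a b c eq = trans (a≡1+a-1 a) (trans (cong (_- 1ℤ) eq) (cancel b c))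
          where
            a≡1+a-1 : ∀ a → a ≡ (1ℤ + a) - 1ℤ
            a≡1+a-1 = solve-∀
            cancel : ∀ b c → ((1ℤ + b) + c) - 1ℤ ≡ b + c
            cancel = solve-∀

    rem-entry-surjective : ∀ {c} → c ℕ.< n → Σ ℕ λ p → p ℕ.< n × rem (entry g p) ≡ c
    rem-entry-surjective {c} c<n with window-representative (preimage g-bij (+ c))
    ... | p , p<n , t , eq = p , p<n , trans (cong rem entry≡) (trans (rem-+* (+ c) (- t)) (m<n⇒m%n≡m c<n))
      where
        x≡a+tM⇒a≡x-tM : ∀ {x a} t M → x ≡ a + t * M → a ≡ x + (- t) * M
        x≡a+tM⇒a≡x-tM {x} {a} t M refl = sym (a+tM-tM≡a a t M)
        entry≡ : entry g p ≡ + c + (- t) * N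
        entry≡ = begin
          g (+ suc p)                               ≡⟨ cong g (x≡a+tM⇒a≡x-tM t N eq) ⟩
          g (preimage g-bij (+ c) + (- t) * N)      ≡⟨ periodic-* (- t) _ ⟩
          g (preimage g-bij (+ c)) + (- t) * N      ≡⟨ cong (_+ (- t) * N) (section g-bij (+ c)) ⟩
          + c + (- t) * N                           ∎
          where open ≡-Reasoning

  id-isPeriodicBijection : IsPeriodicBijection (λ x → x)
  id-isPeriodicBijection = record
    { periodic = λ _ → refl ; preimage = λ y → y ; section = λ _ → refl ; injective = λ eq → eq }

  shift-isPeriodicBijection : ∀ {g} → IsPeriodicBijection g → IsPeriodicBijection (λ x → g x - 1ℤ)
  shift-isPeriodicBijection {g} g-bij = record
    { periodic  = λ x → trans (cong (_- 1ℤ) (periodic g-bij x)) (+-right-comm (g x) N (- 1ℤ))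
    ; preimage  = λ y → preimage g-bij (y + 1ℤ)
    ; section   = λ y → trans (cong (_- 1ℤ) (section g-bij (y + 1ℤ))) (x+1-1≡x y)
    ; injective = λ eq → injective g-bij (∙-cancelʳ (- 1ℤ) _ _ eq)
    }

  affPerm-isPeriodicBijection : (w : AffPerm n) → IsPeriodicBijection (fun w)
  affPerm-isPeriodicBijection w = record
    { periodic  = period w
    ; preimage  = inv w
    ; section   = fun∘inv w
    ; injective = λ {x} {y} eq → trans (sym (inv∘fun w x)) (trans (cong (inv w) eq) (inv∘fun w y))
    }

  -- Shi's formula for the Coxeter length.
  inversions : (ℤ → ℤ) → ℕ
  inversions g = ΣΣ< (λ x y → ∣ quo (entry g y - entry g x) ∣) n

  inversions-cong : ∀ {f g} → (∀ x → f x ≡ g x) → inversions f ≡ inversions g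
  inversions-cong f≗g = ΣΣ<-cong n λ _ _ → cong (∣_∣ ∘ quo) (cong₂ _-_ (f≗g _) (f≗g _))

  inversions-+const : ∀ g k → inversions (λ x → g x + k) ≡ inversions g
  inversions-+const g k = ΣΣ<-cong n λ {x} {y} _ _ → cong (∣_∣ ∘ quo) (cancel-k (entry g y) (entry g x) k)
    where
      cancel-k : ∀ a b k → (a + k) - (b + k) ≡ a - b
      cancel-k = solve-∀

  inversions-id : inversions (λ x → x) ≡ 0
  inversions-id = trans (ΣΣ<-cong n quo-small) (trans (Σ<-cong n λ {y} _ → Σ<-zero y) (Σ<-zero n))
    where
      quo-small : ∀ {x y} → x ℕ.< y → y ℕ.< n → ∣ quo (+ suc y - + suc x) ∣ ≡ 0
      quo-small {x} {y} x<y y<n = cong ∣_∣ (proj₂ (rem-quo-unique (+ suc y - + suc x) 0ℤ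
        (ℕP.≤-<-trans (ℕP.m∸n≤m y x) y<n)
        (trans (ℤP.≤-⊖ (s≤s (ℕP.<⇒≤ x<y))) (sym (ℤP.+-identityʳ _)))))

  PositiveWindow : (ℤ → ℤ) → Set
  PositiveWindow g = ∀ p → p ℕ.< n → 0ℤ ℤ.< entry g p

  isPositive⇒positiveWindow : (w : AffPerm n) → IsPositive w → PositiveWindow (fun w)
  isPositive⇒positiveWindow w w-pos p p<n with window-representative (entry (fun w) p)
  ... | y , y<n , + m , eq =
    subst (0ℤ ℤ.<_) (sym (trans eq (cong (λ z → + suc y + z) (sym (ℤP.pos-* m n))))) (+<+ (s≤s z≤n))
  ... | y , y<n , -[1+ m ] , eq = ⊥-elim (ℤP.<⇒≱ (w-pos (suc y) (s≤s z≤n) y<n) entry≤0)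
    where
      open ≡-Reasoning
      image : fun w (+ suc p + +[1+ m ] * N) ≡ + suc y
      image = begin
        fun w (+ suc p + +[1+ m ] * N)              ≡⟨ periodic-* (affPerm-isPeriodicBijection w) +[1+ m ] (+ suc p) ⟩
        entry (fun w) p + +[1+ m ] * N              ≡⟨ cong (_+ +[1+ m ] * N) eq ⟩
        (+ suc y + -[1+ m ] * N) + +[1+ m ] * N     ≡⟨ a+tM-tM≡a (+ suc y) -[1+ m ] N ⟩
        + suc y                                     ∎
      preimage≡ : inv w (+ suc y) ≡ + (suc p ℕ.+ suc m ℕ.* n)
      preimage≡ = begin
        inv w (+ suc y)                             ≡⟨ cong (inv w) image ⟨
        inv w (fun w (+ suc p + +[1+ m ] * N))      ≡⟨ inv∘fun w _ ⟩
        + suc p + +[1+ m ] * N                      ≡⟨ cong (λ z → + suc p + z) (ℤP.pos-* (suc m) n) ⟨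
        + (suc p ℕ.+ suc m ℕ.* n)                   ∎
      entry≤0 : wordEntry w (suc y) ℤ.≤ + 0
      entry≤0 = subst (ℤ._≤ + 0) (cong (λ z → + suc n - z) (sym preimage≡))
        (ℤP.i≤j⇒i-j≤0 (+≤+ (s≤s (ℕP.≤-trans (ℕP.m≤m+n n (m ℕ.* n)) (ℕP.m≤n+m _ p)))))

  -- When p and q are the window positions of the residues i and i + 1, this says that s_i is a
  -- left descent of g.
  Descent : (ℤ → ℤ) → ℕ → ℕ → Set
  Descent g p q = (p ℕ.< q × entry g p + 1ℤ ℤ.< entry g q) ⊎ (q ℕ.< p × entry g p ℤ.< entry g q)

  -- Simple reflections

  module Reflections (2≤n : 2 ℕ.≤ n) where

    rem-1+*N : ∀ t → rem (1ℤ + t * N) ≡ 1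
    rem-1+*N t = trans (rem-+* 1ℤ t) (m<n⇒m%n≡m 2≤n)

    suc-%≢ : ∀ {i} → i ℕ.< n → suc i ℕ.% n ≢ i
    suc-%≢ i<n eq with suc-%-cases i<n
    ... | inj₁ 1+i%n≡1+i      = ℕP.1+n≢n (trans (sym 1+i%n≡1+i) eq)
    ... | inj₂ (1+i%n≡0 , 1+i≡n) = ℕP.<⇒≱ 2≤n (ℕP.≤-reflexive (trans (sym 1+i≡n) (cong suc (trans (sym eq) 1+i%n≡0))))

    module SimpleReflection (i : Fin n) where
      open ≡-Reasoning

      I J : ℕ
      I = toℕ i
      J = suc I ℕ.% n

      s : ℤ → ℤ
      s = sGen n i

      J≢I : J ≢ I
      J≢I = suc-%≢ (toℕ<n i)

      s-at-I : ∀ x → rem x ≡ I → s x ≡ x + 1ℤ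
      s-at-I x eq rewrite dec-true (rem x ℕ.≟ I) eq = refl

      s-at-J : ∀ x → rem x ≡ J → s x ≡ x - 1ℤ
      s-at-J x eq
        rewrite dec-false (rem x ℕ.≟ I) (J≢I ∘ trans (sym eq)) | dec-true (rem x ℕ.≟ J) eq = refl

      s-elsewhere : ∀ x → rem x ≢ I → rem x ≢ J → s x ≡ x
      s-elsewhere x ≢I ≢J rewrite dec-false (rem x ℕ.≟ I) ≢I | dec-false (rem x ℕ.≟ J) ≢J = refl

      data Position (x : ℤ) : Set where
        at-I      : rem x ≡ I → Position x
        at-J      : rem x ≡ J → Position x
        elsewhere : rem x ≢ I → rem x ≢ J → Position x

      position : ∀ x → Position x
      position x with rem x ℕ.≟ I | rem x ℕ.≟ J
      ... | yes eq | _      = at-I eq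
      ... | no ≢I  | yes eq = at-J eq
      ... | no ≢I  | no ≢J  = elsewhere ≢I ≢J

      rem-+1-at-I : ∀ x → rem x ≡ I → rem (x + 1ℤ) ≡ J
      rem-+1-at-I x eq = trans (rem-+1 x) (cong (λ r → suc r ℕ.% n) eq)

      s-involutive : ∀ x → s (s x) ≡ x
      s-involutive x with position x
      ... | at-I eq         = trans (cong s (s-at-I x eq))
                                    (trans (s-at-J (x + 1ℤ) (rem-+1-at-I x eq)) (x+1-1≡x x))
      ... | at-J eq         = trans (cong s (s-at-J x eq))
                                    (trans (s-at-I (x - 1ℤ) (rem-pred x (toℕ<n i) eq)) (x-1+1≡x x))
      ... | elsewhere ≢I ≢J = trans (cong s (s-elsewhere x ≢I ≢J)) (s-elsewhere x ≢I ≢J)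

      s-periodic : ∀ x → s (x + N) ≡ s x + N
      s-periodic x with position x
      ... | at-I eq         = trans (s-at-I (x + N) (trans (rem-+N x) eq))
                                    (trans (+-right-comm x N 1ℤ) (cong (_+ N) (sym (s-at-I x eq))))
      ... | at-J eq         = trans (s-at-J (x + N) (trans (rem-+N x) eq))
                                    (trans (+-right-comm x N (- 1ℤ)) (cong (_+ N) (sym (s-at-J x eq))))
      ... | elsewhere ≢I ≢J = trans (s-elsewhere (x + N) (≢I ∘ trans (sym (rem-+N x))) (≢J ∘ trans (sym (rem-+N x))))
                                    (cong (_+ N) (sym (s-elsewhere x ≢I ≢J)))

      ∣s∣≤∣∣+1 : ∀ x → ∣ s x ∣ ℕ.≤ ∣ x ∣ ℕ.+ 1
      ∣s∣≤∣∣+1 x with position x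
      ... | at-I eq         = subst (λ y → ∣ y ∣ ℕ.≤ ∣ x ∣ ℕ.+ 1) (sym (s-at-I x eq)) (ℤP.∣i+j∣≤∣i∣+∣j∣ x 1ℤ)
      ... | at-J eq         = subst (λ y → ∣ y ∣ ℕ.≤ ∣ x ∣ ℕ.+ 1) (sym (s-at-J x eq)) (∣i-1∣≤∣i∣+1 x)
      ... | elsewhere ≢I ≢J = subst (λ y → ∣ y ∣ ℕ.≤ ∣ x ∣ ℕ.+ 1) (sym (s-elsewhere x ≢I ≢J)) (ℕP.m≤m+n ∣ x ∣ 1)

      Swapped : ℤ → ℤ → Set
      Swapped a b = (rem a ≡ I × rem b ≡ J) ⊎ (rem a ≡ J × rem b ≡ I)

      quo-diff-unswapped : ∀ a b → rem a ≢ rem b → ¬ Swapped a b → quo (s b - s a) ≡ quo (b - a)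
      quo-diff-unswapped a b a≢b unswapped with position a | position b
      ... | at-I ea | at-I eb = ⊥-elim (a≢b (trans ea (sym eb)))
      ... | at-J ea | at-J eb = ⊥-elim (a≢b (trans ea (sym eb)))
      ... | at-I ea | at-J eb = ⊥-elim (unswapped (inj₁ (ea , eb)))
      ... | at-J ea | at-I eb = ⊥-elim (unswapped (inj₂ (ea , eb)))
      ... | elsewhere ≢I ≢J | elsewhere ≢I′ ≢J′ = cong quo (cong₂ _-_ (s-elsewhere b ≢I′ ≢J′) (s-elsewhere a ≢I ≢J))
      ... | at-I ea | elsewhere ≢I ≢J = begin
        quo (s b - s a)       ≡⟨ cong quo (cong₂ _-_ (s-elsewhere b ≢I ≢J) (s-at-I a ea)) ⟩
        quo (b - (a + 1ℤ))    ≡⟨ cong quo (b-[a+1]≡b-a-1 a b) ⟩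
        quo ((b - a) - 1ℤ)    ≡⟨ quo-pred (b - a) (distinct-rem⇒difference-rem≢0 a b a≢b) ⟩
        quo (b - a)           ∎
      ... | elsewhere ≢I ≢J | at-J eb = begin
        quo (s b - s a)       ≡⟨ cong quo (cong₂ _-_ (s-at-J b eb) (s-elsewhere a ≢I ≢J)) ⟩
        quo ((b - 1ℤ) - a)    ≡⟨ cong quo (b-1-a≡b-a-1 a b) ⟩
        quo ((b - a) - 1ℤ)    ≡⟨ quo-pred (b - a) (distinct-rem⇒difference-rem≢0 a b a≢b) ⟩
        quo (b - a)           ∎
      ... | elsewhere ≢I ≢J | at-I eb = begin
        quo (s b - s a)              ≡⟨ cong quo (cong₂ _-_ (s-at-I b eb) (s-elsewhere a ≢I ≢J)) ⟩
        quo ((b + 1ℤ) - a)           ≡⟨ quo-pred ((b + 1ℤ) - a) (distinct-rem⇒difference-rem≢0 a (b + 1ℤ) a≢b+1) ⟨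
        quo (((b + 1ℤ) - a) - 1ℤ)    ≡⟨ cong quo (b+1-a-1≡b-a a b) ⟩
        quo (b - a)                  ∎
        where
          a≢b+1 : rem a ≢ rem (b + 1ℤ)
          a≢b+1 e = ≢J (trans e (rem-+1-at-I b eb))
      ... | at-J ea | elsewhere ≢I ≢J = begin
        quo (s b - s a)              ≡⟨ cong quo (cong₂ _-_ (s-elsewhere b ≢I ≢J) (s-at-J a ea)) ⟩
        quo (b - (a - 1ℤ))           ≡⟨ quo-pred (b - (a - 1ℤ)) (distinct-rem⇒difference-rem≢0 (a - 1ℤ) b a-1≢b) ⟨
        quo ((b - (a - 1ℤ)) - 1ℤ)    ≡⟨ cong quo (b-[a-1]-1≡b-a a b) ⟩
        quo (b - a)                  ∎
        where
          a-1≢b : rem (a - 1ℤ) ≢ rem b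
          a-1≢b e = ≢I (trans (sym e) (rem-pred a (toℕ<n i) ea))

      rem-differences-at-I-J : ∀ a b → rem a ≡ I → rem b ≡ J → rem (b - a) ≡ 1 × rem ((a + 1ℤ) - (b - 1ℤ)) ≡ 1
      rem-differences-at-I-J a b ea eb =
        trans (cong rem (b≡a+1+tM⇒b-a≡1+tM a b t N b≡)) (rem-1+*N t) ,
        trans (cong rem (b≡a+1+tM⇒[a+1]-[b-1]≡1-tM a b t N b≡)) (rem-1+*N (- t))
        where
          t = quo b - quo (a + 1ℤ)
          b≡ : b ≡ (a + 1ℤ) + t * N
          b≡ = same-rem⇒differ-by-multiple b (a + 1ℤ) (trans eb (sym (rem-+1-at-I a ea)))

      quo-diff-at-I-J : ∀ a b → rem a ≡ I → rem b ≡ J →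
                        rem (b - a) ≡ 1 × quo (s b - s a) ≡ quo (b - a) - 1ℤ
      quo-diff-at-I-J a b ea eb = rem≡1 , (begin
        quo (s b - s a)              ≡⟨ cong quo (cong₂ _-_ (s-at-J b eb) (s-at-I a ea)) ⟩
        quo ((b - 1ℤ) - (a + 1ℤ))    ≡⟨ cong quo (b-1-[a+1]≡b-a-1-1 a b) ⟩
        quo (((b - a) - 1ℤ) - 1ℤ)    ≡⟨ quo-pred² (b - a) rem≡1 ⟩
        quo (b - a) - 1ℤ             ∎)
        where
          rem≡1 : rem (b - a) ≡ 1
          rem≡1 = proj₁ (rem-differences-at-I-J a b ea eb)

      quo-diff-at-J-I : ∀ a b → rem a ≡ I → rem b ≡ J →
                        rem (s a - s b) ≡ 1 × quo (a - b) ≡ quo (s a - s b) - 1ℤ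
      quo-diff-at-J-I a b ea eb = rem≡1 , (begin
        quo (a - b)                        ≡⟨ cong quo (a-b≡[a+1]-[b-1]-1-1 a b) ⟩
        quo (((a + 1ℤ) - (b - 1ℤ) - 1ℤ) - 1ℤ) ≡⟨ cong (λ d → quo ((d - 1ℤ) - 1ℤ)) sa-sb ⟨
        quo ((s a - s b - 1ℤ) - 1ℤ)        ≡⟨ quo-pred² (s a - s b) rem≡1 ⟩
        quo (s a - s b) - 1ℤ               ∎)
        where
          sa-sb : s a - s b ≡ (a + 1ℤ) - (b - 1ℤ)
          sa-sb = cong₂ _-_ (s-at-I a ea) (s-at-J b eb)
          rem≡1 : rem (s a - s b) ≡ 1
          rem≡1 = trans (cong rem sa-sb) (proj₂ (rem-differences-at-I-J a b ea eb))

    reflection-isPeriodicBijection : ∀ i {g} → IsPeriodicBijection g → IsPeriodicBijection (sGen n i ∘ g)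
    reflection-isPeriodicBijection i {g} g-bij = record
      { periodic  = λ x → trans (cong s (periodic g-bij x)) (s-periodic (g x))
      ; preimage  = λ y → preimage g-bij (s y)
      ; section   = λ y → trans (cong s (section g-bij (s y))) (s-involutive y)
      ; injective = λ {x} {y} eq →
          injective g-bij (trans (sym (s-involutive (g x))) (trans (cong s eq) (s-involutive (g y))))
      }
      where open SimpleReflection i

    word-isPeriodicBijection : ∀ u → IsPeriodicBijection (evalS n u)
    word-isPeriodicBijection []      = id-isPeriodicBijection
    word-isPeriodicBijection (i ∷ u) = reflection-isPeriodicBijection i (word-isPeriodicBijection u)

    module _ {g : ℤ → ℤ} (g-bij : IsPeriodicBijection g) (i : Fin n) where
      open SimpleReflection i

      same-position : ∀ {p q c} → p ℕ.< n → q ℕ.< n → rem (entry g p) ≡ c → rem (entry g q) ≡ c → p ≡ q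
      same-position p<n q<n ep eq = rem-entry-injective g-bij p<n q<n (trans ep (sym eq))

      swapped-positions-unique : ∀ {x y x′ y′} → x ℕ.< y → y ℕ.< n → x′ ℕ.< y′ → y′ ℕ.< n →
                                 Swapped (entry g x) (entry g y) → Swapped (entry g x′) (entry g y′) →
                                 x′ ≡ x × y′ ≡ y
      swapped-positions-unique {x} {y} {x′} {y′} x<y y<n x′<y′ y′<n = cases
        where
          x<n  = ℕP.<-trans x<y y<n
          x′<n = ℕP.<-trans x′<y′ y′<n
          reversed : x′ ≡ y → y′ ≡ x → x′ ≡ x × y′ ≡ y
          reversed x′≡y y′≡x = ⊥-elim (ℕP.<-asym x<y (subst₂ ℕ._<_ x′≡y y′≡x x′<y′))
          cases : Swapped (entry g x) (entry g y) → Swapped (entry g x′) (entry g y′) → x′ ≡ x × y′ ≡ y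
          cases (inj₁ (xI , yJ)) (inj₁ (x′I , y′J)) = same-position x′<n x<n x′I xI , same-position y′<n y<n y′J yJ
          cases (inj₂ (xJ , yI)) (inj₂ (x′J , y′I)) = same-position x′<n x<n x′J xJ , same-position y′<n y<n y′I yI
          cases (inj₁ (xI , yJ)) (inj₂ (x′J , y′I)) =
            reversed (same-position x′<n y<n x′J yJ) (same-position y′<n x<n y′I xI)
          cases (inj₂ (xJ , yI)) (inj₁ (x′I , y′J)) =
            reversed (same-position x′<n y<n x′I yI) (same-position y′<n x<n y′J xJ)

      inversions-exchange : ∀ {x y} → x ℕ.< y → y ℕ.< n → Swapped (entry g x) (entry g y) →
        inversions (s ∘ g) ℕ.+ ∣ quo (entry g y - entry g x) ∣ ≡ inversions g ℕ.+ ∣ quo (s (entry g y) - s (entry g x)) ∣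
      inversions-exchange {x} {y} x<y y<n sw = ΣΣ<-update n x<y y<n unchanged
        where
          unchanged : ∀ {x′ y′} → x′ ℕ.< y′ → y′ ℕ.< n → ¬ (x′ ≡ x × y′ ≡ y) →
                      ∣ quo (s (entry g y′) - s (entry g x′)) ∣ ≡ ∣ quo (entry g y′ - entry g x′) ∣
          unchanged {x′} {y′} x′<y′ y′<n other = cong ∣_∣ (quo-diff-unswapped (entry g x′) (entry g y′)
            (ℕP.<⇒≢ x′<y′ ∘ rem-entry-injective g-bij (ℕP.<-trans x′<y′ y′<n) y′<n)
            (other ∘ swapped-positions-unique x<y y<n x′<y′ y′<n sw))

      inversions-reflection : ∀ {p q} → p ℕ.< n → q ℕ.< n → rem (entry g p) ≡ I → rem (entry g q) ≡ J →
        (inversions (s ∘ g) ℕ.≤ inversions g ℕ.+ 1) × (Descent g p q → inversions (s ∘ g) ℕ.+ 1 ≡ inversions g)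
      inversions-reflection {p} {q} p<n q<n pI qJ with ℕP.<-cmp p q
      ... | tri≈ _ p≡q _ = ⊥-elim (J≢I (trans (sym qJ) (trans (cong (rem ∘ entry g) (sym p≡q)) pI)))
      ... | tri< p<q _ _ = +-transfer-≤ exchange bound , descent
        where
          a = entry g p
          b = entry g q
          exchange = inversions-exchange p<q q<n (inj₁ (pI , qJ))
          rem≡1    = proj₁ (quo-diff-at-I-J a b pI qJ)
          quo-step = proj₂ (quo-diff-at-I-J a b pI qJ)
          bound : ∣ quo (s b - s a) ∣ ℕ.≤ ∣ quo (b - a) ∣ ℕ.+ 1
          bound = subst (λ u → ∣ u ∣ ℕ.≤ ∣ quo (b - a) ∣ ℕ.+ 1) (sym quo-step) (∣i-1∣≤∣i∣+1 (quo (b - a)))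
          descent : Descent g p q → inversions (s ∘ g) ℕ.+ 1 ≡ inversions g
          descent (inj₂ (q<p , _))   = ⊥-elim (ℕP.<-asym p<q q<p)
          descent (inj₁ (_ , a+1<b)) = +-transfer-≡ exchange
            (trans (cong (λ u → ∣ u ∣ ℕ.+ 1) quo-step) (0<i⇒∣i-1∣+1≡∣i∣ (rem≡1⇒quo>0 (b - a) rem≡1 1<b-a)))
            where
              1<b-a : 1ℤ ℤ.< b - a
              1<b-a = subst (ℤ._< b - a) (a+1-a≡1 a) (ℤP.+-monoˡ-< (- a) a+1<b)
      ... | tri> _ _ q<p = +-transfer-≤ exchange bound , descent
        where
          a = entry g p
          b = entry g q
          exchange = inversions-exchange q<p p<n (inj₂ (qJ , pI))
          rem≡1    = proj₁ (quo-diff-at-J-I a b pI qJ)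
          quo-step = proj₂ (quo-diff-at-J-I a b pI qJ)
          bound : ∣ quo (s a - s b) ∣ ℕ.≤ ∣ quo (a - b) ∣ ℕ.+ 1
          bound = subst (λ u → ∣ quo (s a - s b) ∣ ℕ.≤ ∣ u ∣ ℕ.+ 1) (sym quo-step) (∣i∣≤∣i-1∣+1 (quo (s a - s b)))
          descent : Descent g p q → inversions (s ∘ g) ℕ.+ 1 ≡ inversions g
          descent (inj₁ (p<q , _)) = ⊥-elim (ℕP.<-asym p<q q<p)
          descent (inj₂ (_ , a<b)) = +-transfer-≡ exchange
            (trans (i≤0⇒∣i∣+1≡∣i-1∣ (rem≡1⇒quo≤0 (s a - s b) rem≡1 sa-sb≤1)) (cong ∣_∣ (sym quo-step)))
            where
              sa-sb≤1 : s a - s b ℤ.≤ 1ℤ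
              sa-sb≤1 = begin
                s a - s b                 ≡⟨ cong₂ _-_ (s-at-I a pI) (s-at-J b qJ) ⟩
                (a + 1ℤ) - (b - 1ℤ)       ≡⟨ [a+1]-[b-1]≡1+a-b+1 a b ⟩
                ((1ℤ + a) - b) + 1ℤ       ≤⟨ ℤP.+-monoˡ-≤ 1ℤ (ℤP.i≤j⇒i-j≤0 (ℤP.i<j⇒suc[i]≤j a<b)) ⟩
                0ℤ + 1ℤ                   ∎
                where open ℤP.≤-Reasoning

    inversions-reflection-≤ : ∀ i {g} → IsPeriodicBijection g → inversions (sGen n i ∘ g) ℕ.≤ inversions g ℕ.+ 1
    inversions-reflection-≤ i g-bij
      with rem-entry-surjective g-bij (toℕ<n i) | rem-entry-surjective g-bij (m%n<n (suc (toℕ i)) n)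
    ... | p , p<n , pI | q , q<n , qJ = proj₁ (inversions-reflection g-bij i p<n q<n pI qJ)

    inversions≤length : ∀ u → inversions (evalS n u) ℕ.≤ length u
    inversions≤length []      = ℕP.≤-reflexive inversions-id
    inversions≤length (i ∷ u) = begin
      inversions (sGen n i ∘ evalS n u)  ≤⟨ inversions-reflection-≤ i (word-isPeriodicBijection u) ⟩
      inversions (evalS n u) ℕ.+ 1       ≤⟨ ℕP.+-monoˡ-≤ 1 (inversions≤length u) ⟩
      length u ℕ.+ 1                     ≡⟨ ℕP.+-comm (length u) 1 ⟩
      suc (length u)                     ∎
      where open ℕP.≤-Reasoning

    -- The greedy factorisation of a positive element

    positive-shift : ∀ {g} → PositiveWindow g → (∀ p → p ℕ.< n → entry g p ≢ 1ℤ) → PositiveWindow (λ x → g x - 1ℤ)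
    positive-shift g-pos ≢1 p p<n = 0<i⇒i≢1⇒0<i-1 (g-pos p p<n) (≢1 p p<n)

    positive-reflection : ∀ i {g} → 1 ℕ.≤ toℕ i → PositiveWindow g → PositiveWindow (sGen n i ∘ g)
    positive-reflection i {g} 1≤I g-pos p p<n = by-position (position x)
      where
        open SimpleReflection i
        x = entry g p
        x>0 = g-pos p p<n
        J≢1 : J ≢ 1
        J≢1 J≡1 with suc-%-cases (toℕ<n i)
        ... | inj₁ J≡1+I     = ℕP.<⇒≢ 1≤I (sym (ℕP.suc-injective (trans (sym J≡1+I) J≡1)))
        ... | inj₂ (J≡0 , _) with () ← trans (sym J≡0) J≡1
        x≢1 : rem x ≡ J → x ≢ 1ℤ
        x≢1 xJ x≡1 = J≢1 (trans (sym xJ) (trans (cong rem x≡1) (m<n⇒m%n≡m 2≤n)))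
        by-position : Position x → 0ℤ ℤ.< s x
        by-position (at-I xI)          = subst (0ℤ ℤ.<_) (sym (s-at-I x xI)) (0<i⇒0<i+1 x>0)
        by-position (at-J xJ)          = subst (0ℤ ℤ.<_) (sym (s-at-J x xJ)) (0<i⇒i≢1⇒0<i-1 x>0 (x≢1 xJ))
        by-position (elsewhere ≢I ≢J)  = subst (0ℤ ℤ.<_) (sym (s-elsewhere x ≢I ≢J)) x>0

    NoWfDescent : (ℤ → ℤ) → Set
    NoWfDescent g = ∀ i → 1 ℕ.≤ toℕ i → inversions (sGen n i ∘ g) ℕ.+ 1 ≢ inversions g

    -- Each value v < n is followed by v + 1 at a later window position; starting from the value 1
    -- this forces the window to be 1, 2, …, n.
    module _ {g : ℤ → ℤ} (g-bij : IsPeriodicBijection g) (g-pos : PositiveWindow g)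
             (no-descent : NoWfDescent g) where

      later-if-larger : ∀ {p q} → ¬ Descent g p q → entry g p ℤ.< entry g q → p ℕ.< q
      later-if-larger {p} {q} ¬desc gp<gq with ℕP.<-cmp p q
      ... | tri< p<q _ _ = p<q
      ... | tri≈ _ refl _ = ⊥-elim (ℤP.<-irrefl refl gp<gq)
      ... | tri> _ _ q<p = ⊥-elim (¬desc (inj₂ (q<p , gp<gq)))

      next-value-later : ∀ {p v} → p ℕ.< n → entry g p ≡ + v → 1 ℕ.≤ v → v ℕ.< n →
                         Σ ℕ λ q → q ℕ.< n × p ℕ.< q × entry g q ≡ + suc v
      next-value-later {p} {v} p<n gp≡v 1≤v v<n
        with rem-entry-surjective g-bij (m%n<n (suc v) n)
      ... | q , q<n , qJ = by-multiple t gq≡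
        where
          i = fromℕ< v<n
          open SimpleReflection i
          I≡v : I ≡ v
          I≡v = toℕ-fromℕ< v<n
          pI : rem (entry g p) ≡ I
          pI = trans (cong rem gp≡v) (trans (m<n⇒m%n≡m v<n) (sym I≡v))
          qJ′ : rem (entry g q) ≡ J
          qJ′ = trans qJ (cong (λ k → suc k ℕ.% n) (sym I≡v))
          ¬desc : ¬ Descent g p q
          ¬desc = no-descent i (subst (1 ℕ.≤_) (sym I≡v) 1≤v) ∘ proj₂ (inversions-reflection g-bij i p<n q<n pI qJ′)
          t = quo (entry g q) - quo (+ suc v)
          gq≡ : entry g q ≡ + suc v + t * N
          gq≡ = same-rem⇒differ-by-multiple (entry g q) (+ suc v) qJ
          by-multiple : ∀ t → entry g q ≡ + suc v + t * N → Σ ℕ λ q′ → q′ ℕ.< n × p ℕ.< q′ × entry g q′ ≡ + suc v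
          by-multiple (+ zero) eq =
            q , q<n , later-if-larger ¬desc (subst₂ ℤ._<_ (sym gp≡v) (sym eq′) (+<+ (ℕP.n<1+n v))) , eq′
            where
              eq′ : entry g q ≡ + suc v
              eq′ = trans eq (ℤP.+-identityʳ _)
          by-multiple +[1+ k ] eq = ⊥-elim (¬desc (inj₁ (later-if-larger ¬desc gp<gq , gp+1<gq)))
            where
              gp+1<gq : entry g p + 1ℤ ℤ.< entry g q
              gp+1<gq = subst₂ ℤ._<_ (cong (_+ 1ℤ) (sym gp≡v))
                (sym (trans eq (cong (λ z → + suc v + z) (sym (ℤP.pos-* (suc k) n)))))
                (+<+ (subst (ℕ._< suc v ℕ.+ suc k ℕ.* n) (ℕP.+-comm 1 v)
                  (ℕP.m<m+n (suc v) (ℕP.<-≤-trans 0<n (ℕP.m≤m+n n (k ℕ.* n))))))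
              gp<gq : entry g p ℤ.< entry g q
              gp<gq = ℤP.≤-<-trans (ℤP.i≤i+j (entry g p) 1ℤ) gp+1<gq
          by-multiple -[1+ m ] eq = ⊥-elim (ℤP.<⇒≱ (g-pos q q<n) (subst (ℤ._≤ 0ℤ) (sym eq) [1+v]-[1+m]N≤0))
            where
              [1+v]-[1+m]N≤0 : + suc v + -[1+ m ] * N ℤ.≤ 0ℤ
              [1+v]-[1+m]N≤0 = subst (ℤ._≤ 0ℤ) (cong (λ z → + suc v + z) (ℤP.neg-distribˡ-* +[1+ m ] N))
                (subst (λ z → + suc v - z ℤ.≤ 0ℤ) (ℤP.pos-* (suc m) n)
                  (ℤP.i≤j⇒i-j≤0 (+≤+ (ℕP.≤-trans v<n (ℕP.m≤m+n n (m ℕ.* n))))))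

      room-after : ∀ k {p v} → p ℕ.< n → entry g p ≡ + v → 1 ℕ.≤ v → v ℕ.+ k ≡ n → suc p ℕ.+ k ℕ.≤ n
      room-after zero {p} p<n _ _ _ = subst (ℕ._≤ n) (sym (ℕP.+-identityʳ (suc p))) p<n
      room-after (suc k) {p} {v} p<n gp≡v 1≤v v+[1+k]≡n
        with next-value-later p<n gp≡v 1≤v (subst (v ℕ.<_) v+[1+k]≡n (ℕP.m<m+n v (s≤s z≤n)))
      ... | q , q<n , p<q , gq≡1+v = begin
        suc p ℕ.+ suc k     ≡⟨ ℕP.+-suc (suc p) k ⟩
        suc (suc p) ℕ.+ k   ≤⟨ ℕP.+-monoˡ-≤ k (s≤s p<q) ⟩
        suc q ℕ.+ k         ≤⟨ room-after k q<n gq≡1+v (s≤s z≤n) (trans (sym (ℕP.+-suc v k)) v+[1+k]≡n) ⟩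
        n                   ∎
        where open ℕP.≤-Reasoning

      module _ (one-in-window : Σ ℕ λ p → p ℕ.< n × entry g p ≡ 1ℤ) where

        position-of-value : ∀ k → k ℕ.< n → Σ ℕ λ p → p ℕ.< n × entry g p ≡ + suc k × k ℕ.≤ p
        position-of-value zero _ = proj₁ one-in-window , proj₁ (proj₂ one-in-window) , proj₂ (proj₂ one-in-window) , z≤n
        position-of-value (suc k) 1+k<n with position-of-value k (ℕP.<-trans (ℕP.n<1+n k) 1+k<n)
        ... | p , p<n , gp≡1+k , k≤p with next-value-later p<n gp≡1+k (s≤s z≤n) 1+k<n
        ... | q , q<n , p<q , gq≡2+k = q , q<n , gq≡2+k , ℕP.≤-<-trans k≤p p<q

        entry-fixed : ∀ k → k ℕ.< n → entry g k ≡ + suc k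
        entry-fixed k k<n with position-of-value k k<n
        ... | p , p<n , gp≡1+k , k≤p = subst (λ z → entry g z ≡ + suc k) p≡k gp≡1+k
          where
            n≡1+k+rest : suc k ℕ.+ (n ℕ.∸ suc k) ≡ n
            n≡1+k+rest = ℕP.m+[n∸m]≡n k<n
            p≤k : p ℕ.≤ k
            p≤k = ℕP.≤-pred (ℕP.+-cancelʳ-≤ (n ℕ.∸ suc k) (suc p) (suc k)
                    (subst (suc p ℕ.+ (n ℕ.∸ suc k) ℕ.≤_) (sym n≡1+k+rest)
                      (room-after (n ℕ.∸ suc k) p<n gp≡1+k (s≤s z≤n) n≡1+k+rest)))
            p≡k : p ≡ k
            p≡k = ℕP.≤-antisym p≤k k≤p

        no-descent⇒identity : ∀ x → g x ≡ x
        no-descent⇒identity x with window-representative x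
        ... | p , p<n , t , refl = trans (periodic-* g-bij t (+ suc p)) (cong (_+ t * N) (entry-fixed p p<n))

    record Factorisation (g : ℤ → ℤ) : Set where
      field
        word      : List (Fin n)
        words     : List (List (Fin n))
        finite    : All IsWfWord (word ∷ words)
        evaluates : ∀ x → g x ≡ evalExpr n word words x
        reduced   : totalLength word words ≡ inversions g

    evalExpr-∷ : ∀ i v vs x → evalExpr n (i ∷ v) vs x ≡ sGen n i (evalExpr n v vs x)
    evalExpr-∷ i v []      x = refl
    evalExpr-∷ i v (_ ∷ _) x = refl

    factorisation-id : ∀ {g} → (∀ x → g x ≡ x) → Factorisation g
    factorisation-id g≗id = record
      { word = [] ; words = [] ; finite = [] ∷ [] ; evaluates = g≗id
      ; reduced = sym (trans (inversions-cong g≗id) inversions-id) }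

    factorisation-shift : ∀ {g} → Factorisation (λ x → g x - 1ℤ) → Factorisation g
    factorisation-shift {g} F = record
      { word = [] ; words = word ∷ words ; finite = [] ∷ finite
      ; evaluates = λ x → trans (sym (x-1+1≡x (g x))) (cong (_+ 1ℤ) (evaluates x))
      ; reduced = trans reduced (inversions-+const g (- 1ℤ)) }
      where
        open Factorisation F

    factorisation-reflection : ∀ i {g} → 1 ℕ.≤ toℕ i → inversions (sGen n i ∘ g) ℕ.+ 1 ≡ inversions g →
                               Factorisation (sGen n i ∘ g) → Factorisation g
    factorisation-reflection i {g} 1≤i descent F = record
      { word = i ∷ word ; words = words
      ; finite = (1≤i ∷ finite-word) ∷ finite-words
      ; evaluates = λ x → trans (sym (s-involutive (g x))) (trans (cong s (evaluates x)) (sym (evalExpr-∷ i word words x)))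
      ; reduced = trans (cong suc reduced) (trans (ℕP.+-comm 1 _) descent) }
      where
        open Factorisation F
        open SimpleReflection i
        finite-word  = All.head finite
        finite-words = All.tail finite

    -- Splitting off π keeps the inversion count and lowers g(1) by one; splitting off a descent
    -- lowers the inversion count by one and changes g(1) by at most one.
    measure : (ℤ → ℤ) → ℕ
    measure g = (inversions g ℕ.+ inversions g) ℕ.+ ∣ g 1ℤ ∣

    construct : ∀ c {g} → IsPeriodicBijection g → PositiveWindow g → measure g ℕ.< c → Factorisation g
    construct (suc c) {g} g-bij g-pos μ<1+c with any? (λ p → entry g (toℕ p) ℤ.≟ 1ℤ)
    ... | no no-one = factorisation-shift (construct c (shift-isPeriodicBijection g-bij) (positive-shift {g} g-pos ≢1)
          (ℕP.<-≤-trans (measure-shift (inversions-+const g (- 1ℤ)) (0<i⇒∣i-1∣+1≡∣i∣ (g-pos 0 0<n))) (ℕP.≤-pred μ<1+c)))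
      where
        ≢1 : ∀ p → p ℕ.< n → entry g p ≢ 1ℤ
        ≢1 p p<n gp≡1 = no-one (fromℕ< p<n , subst (λ k → entry g k ≡ 1ℤ) (sym (toℕ-fromℕ< p<n)) gp≡1)
    ... | yes (p , gp≡1) with any? (λ i → (1 ℕ.≤? toℕ i) ×-dec (inversions (sGen n i ∘ g) ℕ.+ 1 ℕ.≟ inversions g))
    ...   | yes (i , 1≤i , descent) = factorisation-reflection i 1≤i descent
            (construct c (reflection-isPeriodicBijection i g-bij) (positive-reflection i {g} 1≤i g-pos)
              (ℕP.<-≤-trans (measure-reflection descent (SimpleReflection.∣s∣≤∣∣+1 i (g 1ℤ))) (ℕP.≤-pred μ<1+c)))
    ...   | no no-descent = factorisation-id
            (no-descent⇒identity g-bij g-pos (λ i 1≤i d → no-descent (i , 1≤i , d)) (toℕ p , toℕ<n p , gp≡1))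

    factorise : ∀ {g} → IsPeriodicBijection g → PositiveWindow g → Factorisation g
    factorise g-bij g-pos = construct _ g-bij g-pos (ℕP.n<1+n _)

    -- Moving π to the left

    pred-mod : ∀ m → m ℕ.< n → Fin n
    pred-mod zero    _     = fromℕ< n∸1<n
    pred-mod (suc m) 1+m<n = fromℕ< (ℕP.<-trans (ℕP.n<1+n m) 1+m<n)

    suc-pred-mod : ∀ m (m<n : m ℕ.< n) → suc (toℕ (pred-mod m m<n)) ℕ.% n ≡ m
    suc-pred-mod zero    _     =
      trans (cong (λ k → suc k ℕ.% n) (toℕ-fromℕ< n∸1<n)) (trans (cong (ℕ._% n) (sym n≡1+[n∸1])) (n%n≡0 n))
    suc-pred-mod (suc m) 1+m<n = trans (cong (λ k → suc k ℕ.% n) (toℕ-fromℕ< _)) (m<n⇒m%n≡m 1+m<n)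

    pred-letter : Fin n → Fin n
    pred-letter i = pred-mod (toℕ i) (toℕ<n i)

    reflection-+1 : ∀ i y → sGen n i (y + 1ℤ) ≡ sGen n (pred-letter i) y + 1ℤ
    reflection-+1 i y = by-position (B.position y)
      where
        module A = SimpleReflection i
        module B = SimpleReflection (pred-letter i)
        J-B≡I-A : B.J ≡ A.I
        J-B≡I-A = suc-pred-mod (toℕ i) (toℕ<n i)
        by-position : B.Position y → A.s (y + 1ℤ) ≡ B.s y + 1ℤ
        by-position (B.at-I yI) =
          trans (A.s-at-I (y + 1ℤ) (trans (B.rem-+1-at-I y yI) J-B≡I-A)) (cong (_+ 1ℤ) (sym (B.s-at-I y yI)))
        by-position (B.at-J yJ) =
          trans (A.s-at-J (y + 1ℤ) (A.rem-+1-at-I y (trans yJ J-B≡I-A)))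
                (trans (trans (x+1-1≡x y) (sym (x-1+1≡x y))) (cong (_+ 1ℤ) (sym (B.s-at-J y yJ))))
        by-position (B.elsewhere ≢I ≢J) =
          trans (A.s-elsewhere (y + 1ℤ) ≢I-A ≢J-A) (cong (_+ 1ℤ) (sym (B.s-elsewhere y ≢I ≢J)))
          where
            ≢I-A : rem (y + 1ℤ) ≢ A.I
            ≢I-A eq = ≢I (suc-%-injective (rem<n y) (toℕ<n (pred-letter i))
                                           (trans (sym (rem-+1 y)) (trans eq (sym J-B≡I-A))))
            ≢J-A : rem (y + 1ℤ) ≢ A.J
            ≢J-A eq = ≢J (trans (suc-%-injective (rem<n y) (toℕ<n i) (trans (sym (rem-+1 y)) eq)) (sym J-B≡I-A))

    evalS-+1 : ∀ u y → evalS n u (y + 1ℤ) ≡ evalS n (map pred-letter u) y + 1ℤ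
    evalS-+1 []      y = refl
    evalS-+1 (i ∷ u) y = trans (cong (sGen n i) (evalS-+1 u y)) (reflection-+1 i (evalS n (map pred-letter u) y))

    rotate : ℕ → List (Fin n) → List (Fin n)
    rotate zero    u = u
    rotate (suc k) u = rotate k (map pred-letter u)

    length-rotate : ∀ k u → length (rotate k u) ≡ length u
    length-rotate zero    u = refl
    length-rotate (suc k) u = trans (length-rotate k (map pred-letter u)) (length-map pred-letter u)

    evalS-+ : ∀ k u y → evalS n u (y + + k) ≡ evalS n (rotate k u) y + + k
    evalS-+ zero    u y = trans (cong (evalS n u) (ℤP.+-identityʳ y)) (sym (ℤP.+-identityʳ _))
    evalS-+ (suc k) u y = begin
      evalS n u (y + + suc k)                            ≡⟨ cong (evalS n u) (y+[1+k]≡[y+k]+1 y (+ k)) ⟩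
      evalS n u ((y + + k) + 1ℤ)                         ≡⟨ evalS-+1 u (y + + k) ⟩
      evalS n (map pred-letter u) (y + + k) + 1ℤ         ≡⟨ cong (_+ 1ℤ) (evalS-+ k (map pred-letter u) y) ⟩
      (evalS n (rotate (suc k) u) y + + k) + 1ℤ          ≡⟨ y+[1+k]≡[y+k]+1 (evalS n (rotate (suc k) u) y) (+ k) ⟨
      evalS n (rotate (suc k) u) y + + suc k             ∎
      where open ≡-Reasoning

    evalS-++ : ∀ u u′ x → evalS n (u ++ u′) x ≡ evalS n u (evalS n u′ x)
    evalS-++ []      u′ x = refl
    evalS-++ (i ∷ u) u′ x = cong (sGen n i) (evalS-++ u u′ x)

    expression-normal-form : ∀ v vs → Σ ℕ λ k → Σ (List (Fin n)) λ u →
                             (∀ x → evalExpr n v vs x ≡ evalS n u x + + k) × length u ≡ totalLength v vs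
    expression-normal-form v [] = 0 , v , (λ x → sym (ℤP.+-identityʳ _)) , sym (ℕP.+-identityʳ (length v))
    expression-normal-form v (v′ ∷ vs) with expression-normal-form v′ vs
    ... | k , u , eval , len = suc k , rotate (suc k) v ++ u , eval′ ,
          trans (length-++ (rotate (suc k) v)) (cong₂ ℕ._+_ (length-rotate (suc k) v) len)
      where
        eval′ : ∀ x → evalExpr n v (v′ ∷ vs) x ≡ evalS n (rotate (suc k) v ++ u) x + + suc k
        eval′ x = begin
          evalS n v (evalExpr n v′ vs x + 1ℤ)                 ≡⟨ cong (λ z → evalS n v (z + 1ℤ)) (eval x) ⟩
          evalS n v ((evalS n u x + + k) + 1ℤ)                ≡⟨ cong (evalS n v) (y+[1+k]≡[y+k]+1 (evalS n u x) (+ k)) ⟨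
          evalS n v (evalS n u x + + suc k)                   ≡⟨ evalS-+ (suc k) v (evalS n u x) ⟩
          evalS n (rotate (suc k) v) (evalS n u x) + + suc k  ≡⟨ cong (_+ + suc k) (evalS-++ (rotate (suc k) v) u x) ⟨
          evalS n (rotate (suc k) v ++ u) x + + suc k         ∎
          where open ≡-Reasoning

    factorisation-isLength : (w : AffPerm n) (F : Factorisation (fun w)) →
                             IsLength n w (totalLength (Factorisation.word F) (Factorisation.words F))
    factorisation-isLength w F with expression-normal-form (Factorisation.word F) (Factorisation.words F)
    ... | k , u , eval , len = (+ k , u , (λ x → trans (evaluates x) (eval x)) , len) , minimal
      where
        open Factorisation F
        minimal : ∀ k′ u′ → (∀ x → fun w x ≡ πpow k′ (evalS n u′ x)) → totalLength word words ℕ.≤ length u′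
        minimal k′ u′ w≡π^k′u′ = begin
          totalLength word words                      ≡⟨ reduced ⟩
          inversions (fun w)                          ≡⟨ inversions-cong w≡π^k′u′ ⟩
          inversions (λ x → evalS n u′ x + k′)        ≡⟨ inversions-+const (evalS n u′) k′ ⟩
          inversions (evalS n u′)                     ≤⟨ inversions≤length u′ ⟩
          length u′                                   ∎
          where open ℕP.≤-Reasoning

mainTheorem8 : (n : ℕ) .{{_ : NonZero n}} → 2 ℕ.≤ n →
    (w : AffPerm n) → IsPositive w →
    Σ (List (Fin n)) λ v → Σ (List (List (Fin n))) λ vs →
    All IsWfWord (v ∷ vs)
    × (∀ (x : ℤ) → fun w x ≡ evalExpr n v vs x)
    × IsLength n w (totalLength v vs)
mainTheorem8 n 2≤n w w-pos = word , words , finite , evaluates , factorisation-isLength w F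
  where
    open AffinePermutations n
    open Reflections 2≤n
    F : Factorisation (fun w)
    F = factorise (affPerm-isPeriodicBijection w) (isPositive⇒positiveWindow w w-pos)
    open Factorisation F
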